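{- Let $(\mathcal{R},\leq,r)$ be a \textbf{wA2}-space. Let $\mathcal{X}_n\subseteq\mathcal{R}$ for each $n<\omega$ and let $\mathcal{X}:=\bigcap_{n<\omega}\mathcal{X}_n$. Then for any $A\in\mathcal{R}$ and $a\in\mathcal{AR}{\upharpoonright}A$ there exists $B\in[a,A]$ such that one of the following holds: (1) Player I has a strategy in $K[a,B]$ to reach $\mathcal{X}$; (2) Player II has a strategy $\tau$ in $K[a,B]$ such that for every complete play following $\tau$ there is some $n<\omega$ such that, letting $c$ be the last element of $\mathcal{AR}$ and $C$ the last element of $\mathcal{R}$ played by II within the first $n$ rounds of that play (with $c=a$ and $C=B$ if $n=0$), player I has no strategy in $K[c,C]$ to reach $\mathcal{X}_n$.
   Context: $\mathcal{R}$ nonempty, $\le$ quasi-order on $\mathcal{R}$, $r:\mathcal{R}\times\omega\to\mathcal{AR}$, $r_n(A):=r(A,n)$, $\mathcal{AR}_n$ the image of $r_n$. A1: (1) $r_0(A)=\emptyset$; (2) $A\ne B\Rightarrow r_n(A)\ne r_n(B)$ for some $n$; (3) $r_n(A)=r_m(B)\Rightarrow n=m$ and $r_k(A)=r_k(B)$ for $k<n$. $\mathrm{lh}(a)$: the $n$ with $a\in\mathcal{AR}_n$; $a\sqsubseteq b$ iff $a=r_m(A)$, $b=r_n(A)$ for some $A$, $m\le n$. wA2: a quasi-order $\leq_{\mathrm{fin}}$ on $\mathcal{AR}$ with (w1) $\{a:a\leq_{\mathrm{fin}}b\}$ countable; (2) $A\le B$ iff $\forall n\exists m\ r_n(A)\leq_{\mathrm{fin}}r_m(B)$;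 (3) $a\sqsubseteq b\leq_{\mathrm{fin}}c\Rightarrow\exists d\sqsubseteq c\ a\leq_{\mathrm{fin}}d$. $[a,A]=\{B\le A:\exists n\ r_n(B)=a\}$; $[n,A]=[r_n(A),A]$; $\mathrm{depth}_B(a)=\min\{n:a\leq_{\mathrm{fin}}r_n(B)\}$ or $\infty$; $\mathcal{AR}{\upharpoonright}A=\{a:\exists n\ a\leq_{\mathrm{fin}}r_n(A)\}$; $r_n[a,A]=\{b\in\mathcal{AR}{\upharpoonright}A:a\sqsubseteq b,\mathrm{lh}(b)=n\}$. A3: (1) $\mathrm{depth}_B(a)<\infty\Rightarrow[a,A]\ne\emptyset$ for all $A\in[\mathrm{depth}_B(a),B]$; (2) $A\le B$, $[a,A]\ne\emptyset\Rightarrow\exists A'\in[\mathrm{depth}_B(a),B]$ with $\emptyset\ne[a,A']\subseteq[a,A]$. A \textbf{wA2}-space: A1, wA2, A3 hold and $\mathcal{R}$ (identified with $\{(r_n(A))_n\}$) is closed in $\mathcal{AR}^{\mathbb N}$. Kastanas game $K[a,A]$: with $a_0=a$, $B_{ -1}=A$, in round $n\ge0$ I plays $A_n\in[a_n,B_{n-1}]$, then II plays $a_{n+1}\in r_{\mathrm{lh}(a_n)+1}[a_n,A_n]$ and $B_n\in[a_{n+1},A_n]$. Outcome: the $B\in\mathcal{R}$ with $r_{\mathrm{lh}(a)+n}(B)=a_n$ for all $n$. A strategy "reaches" $\mathcal{Y}$ if it ensures the outcome is in $\mathcal{Y}$. -}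

module Defs where

open import Level using (0ℓ)
open import Data.Nat using (ℕ; zero; suc; _+_; _≤_; _<_)
open import Data.List using (List; applyUpTo)
open import Data.Product using (Σ; ∃; ∃-syntax; Σ-syntax; _×_; _,_)
open import Data.Sum using (_⊎_)
open import Relation.Nullary using (¬_)
open import Relation.Binary.PropositionalEquality using (_≡_; _≢_)

record WA2Space : Set₁ where
  field
    R   : Set
    AR  : Set
    R-nonempty : R
    _≼_ : R → R → Set
    ≤-refl  : ∀ A → A ≼ A
    ≤-trans : ∀ {A B C} → A ≼ B → B ≼ C → A ≼ C
    r   : R → ℕ → AR
    AR-image : ∀ (a : AR) → ∃[ A ] ∃[ n ] r A n ≡ a
    ∅    : AR
    A1-1 : ∀ A → r A 0 ≡ ∅
    A1-2 : ∀ A B → A ≢ B → ∃[ n ] r A n ≢ r B n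
    A1-3 : ∀ A B n m → r A n ≡ r B m → (n ≡ m) × (∀ k → k < n → r A k ≡ r B k)

  -- lh(a) = n  (well defined by A1(3))
  IsLh : AR → ℕ → Set
  IsLh a n = ∃[ A ] r A n ≡ a

  _⊑_ : AR → AR → Set
  a ⊑ b = ∃[ A ] ∃[ m ] ∃[ n ] (m ≤ n) × (r A m ≡ a) × (r A n ≡ b)

  field
    _≤fin_ : AR → AR → Set
    ≤fin-refl  : ∀ a → a ≤fin a
    ≤fin-trans : ∀ {a b c} → a ≤fin b → b ≤fin c → a ≤fin c
    -- (w1) {a : a ≤fin b} is countable (injects into ℕ)
    w1 : ∀ b → Σ[ f ∈ (AR → ℕ) ] (∀ x y → x ≤fin b → y ≤fin b → f x ≡ f y → x ≡ y)
    w2-⇒ : ∀ A B → A ≼ B → ∀ n → ∃[ m ] r A n ≤fin r B m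
    w2-⇐ : ∀ A B → (∀ n → ∃[ m ] r A n ≤fin r B m) → A ≼ B
    w3 : ∀ a b c → a ⊑ b → b ≤fin c → ∃[ d ] (d ⊑ c) × (a ≤fin d)

  Box : AR → R → R → Set
  Box a A B = (B ≼ A) × (∃[ n ] r B n ≡ a)

  DepthIs : R → AR → ℕ → Set
  DepthIs B a n = (a ≤fin r B n) × (∀ k → k < n → ¬ (a ≤fin r B k))

  field
    A3-1 : ∀ B a n → DepthIs B a n → ∀ A → Box (r B n) B A → ∃[ C ] Box a A C
    A3-2 : ∀ A B a → A ≼ B → (∃[ C ] Box a A C) → ∀ n → DepthIs B a n →
           ∃[ A' ] Box (r B n) B A' × (∃[ C ] Box a A' C) × (∀ C → Box a A' C → Box a A C)
    -- R (identified with the sequences (r_n(A))_n) is closed in AR^ℕ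
    closed : ∀ (s : ℕ → AR) → (∀ n → ∃[ A ] (∀ k → k < n → r A k ≡ s k)) →
             ∃[ B ] (∀ k → r B k ≡ s k)

  Restr : R → AR → Set
  Restr A a = ∃[ n ] a ≤fin r A n

  RBox : ℕ → AR → R → AR → Set
  RBox n a A b = Restr A b × (a ⊑ b) × IsLh b n

  -- The Kastanas game K[a, A].
  -- A run is described by I's moves As n = A_n and II's moves
  -- as n = a_{n+1}, Bs n = B_n.
  module Run (a : AR) (A : R) (As : ℕ → R) (as : ℕ → AR) (Bs : ℕ → R) where
    cur : ℕ → AR
    cur zero    = a
    cur (suc n) = as n
    prev : ℕ → R
    prev zero    = A
    prev (suc n) = Bs n

    ILegal : ℕ → Set
    ILegal n = Box (cur n) (prev n) (As n)

    IILegal : ℕ → Set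
    IILegal n = (∃[ m ] IsLh (cur n) m × RBox (suc m) (cur n) (As n) (as n))
              × Box (as n) (As n) (Bs n)

    Complete : Set
    Complete = ∀ n → ILegal n × IILegal n

    IsOutcome : R → Set
    IsOutcome B = ∀ m → IsLh a m → ∀ n → r B (m + n) ≡ cur n

  -- Strategies for I see II's previous moves (I's own moves are determined).
  IStrategy : Set
  IStrategy = List (AR × R) → R

  IIStrategy : Set
  IIStrategy = List R → AR × R

  FollowsI : IStrategy → (ℕ → R) → (ℕ → AR) → (ℕ → R) → Set
  FollowsI σ As as Bs = ∀ n → As n ≡ σ (applyUpTo (λ k → as k , Bs k) n)

  FollowsII : IIStrategy → (ℕ → R) → (ℕ → AR) → (ℕ → R) → Set
  FollowsII τ As as Bs = ∀ n → (as n , Bs n) ≡ τ (applyUpTo As (suc n))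

  IReachesWith : AR → R → (R → Set) → IStrategy → Set
  IReachesWith a A 𝒴 σ = ∀ As as Bs → FollowsI σ As as Bs →
      let open Run a A As as Bs in
      ((∀ n → (∀ k → k < n → ILegal k × IILegal k) → ILegal n)
      × (Complete → ∃[ B ] IsOutcome B × 𝒴 B))

  IReaches : AR → R → (R → Set) → Set
  IReaches a A 𝒴 = ∃[ σ ] IReachesWith a A 𝒴 σ

  IILegalStrategy : AR → R → IIStrategy → Set
  IILegalStrategy a A τ = ∀ As as Bs → FollowsII τ As as Bs →
      let open Run a A As as Bs in
      ∀ n → (∀ k → k ≤ n → ILegal k) → (∀ k → k < n → IILegal k) → IILegal n

  IIAlternative : AR → R → (ℕ → R → Set) → Set
  IIAlternative a B 𝒳 = ∃[ τ ] IILegalStrategy a B τ ×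
      (∀ As as Bs → FollowsII τ As as Bs → Run.Complete a B As as Bs →
        ∃[ n ] ¬ IReaches (Run.cur a B As as Bs n) (Run.prev a B As as Bs n) (𝒳 n))

{-# OPTIONS --safe #-}
-- Call (c, C) good at level n if for no C' ∈ [c, C] does II have a strategy in K[c, C'] forcing
-- a round k from which I cannot reach X_(n+k). If II has such a strategy in K[a, B] for some
-- B ∈ [a, A], (2) holds; otherwise every B ∈ [a, A] is good at level 0. From a good position I
-- can reach X_n, and I has a move after which every legal reply of II is good at the next level:
-- else II's escaping replies amalgamate into a strategy that witnesses badness. Player I then
-- plays diagonally: at round t he nests, inside such a good move, the strategies reaching
-- X_0, ..., X_t that were started at rounds 0, ..., t, each one shrinking the previous. Each
-- sub-game is then a legal play of its reaching strategy, and all of them have the same outcome,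
-- which therefore lies in every X_n.
module Submission where

open import Defs
open import Axiom.DoubleNegationElimination using (em⇒dne)
open import Axiom.ExcludedMiddle using (ExcludedMiddle)
open import Data.List using (List; []; _∷_; _∷ʳ_; applyUpTo; foldl; length)
open import Data.List.Properties using (applyUpTo-∷ʳ; foldl-∷ʳ; length-applyUpTo)
open import Data.Nat using (ℕ; zero; suc; _+_; _∸_; _≤_; _<_; z≤n; s≤s)
open import Data.Nat.Induction using (<-rec)
open import Data.Nat.Properties
  using (≤-refl; ≤-trans; ≤-pred; <⇒≤; <-trans; <-≤-trans; n≤1+n; n<1+n; m≤n⇒m≤1+n; m≤m+n; m≤n+m;
         m≤n⇒m<n∨m≡n; +-identityʳ; +-suc; +-assoc; +-monoʳ-<; m+[n∸m]≡n; m+n∸m≡n)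
open import Data.Sum using (_⊎_; inj₁; inj₂)
open import Data.Product using (∃; ∃-syntax; _×_; _,_; proj₁; proj₂)
open import Function using (id; _∘_; _$_)
open import Level using (0ℓ)
open import Relation.Nullary using (¬_; Dec; yes; no; contradiction)
open import Relation.Binary.PropositionalEquality
  using (_≡_; refl; sym; trans; cong; cong₂; subst; module ≡-Reasoning)

applyUpTo-cong : {A : Set} {f g : ℕ → A} → ∀ n → (∀ i → i < n → f i ≡ g i) →
                 applyUpTo f n ≡ applyUpTo g n
applyUpTo-cong zero    f≗g = refl
applyUpTo-cong (suc n) f≗g =
  cong₂ _∷_ (f≗g 0 (s≤s z≤n)) (applyUpTo-cong n λ i i<n → f≗g (suc i) (s≤s i<n))

m≤n⇒o<n∸m⇒m+o<n : ∀ {m n o} → m ≤ n → o < n ∸ m → m + o < n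
m≤n⇒o<n∸m⇒m+o<n {m} m≤n o<n∸m = subst (m + _ <_) (m+[n∸m]≡n m≤n) (+-monoʳ-< m o<n∸m)

m≤2+[m+n] : ∀ m n → m ≤ 2 + (m + n)
m≤2+[m+n] m n = m≤n⇒m≤1+n (m≤n⇒m≤1+n (m≤m+n m n))

≤-elim : (P : ℕ → Set) → ∀ {s t} → s ≤ t → (s < t → P s) → P t → P s
≤-elim P s≤t before now with m≤n⇒m<n∨m≡n s≤t
... | inj₁ s<t  = before s<t
... | inj₂ refl = now

lookupOr : {A : Set} → A → List A → ℕ → A
lookupOr d []       _       = d
lookupOr d (x ∷ xs) zero    = x
lookupOr d (x ∷ xs) (suc i) = lookupOr d xs i

lookupOr-applyUpTo : {A : Set} (d : A) (f : ℕ → A) → ∀ n i → i < n →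
                     lookupOr d (applyUpTo f n) i ≡ f i
lookupOr-applyUpTo d f (suc n) zero    _         = refl
lookupOr-applyUpTo d f (suc n) (suc i) (s≤s i<n) = lookupOr-applyUpTo d (f ∘ suc) n i i<n

witnessOr : {A : Set} {P : A → Set} → A → Dec (∃ P) → A
witnessOr _ (yes (x , _)) = x
witnessOr d (no _)        = d

witnessOr-spec : {A : Set} {P : A → Set} (d : A) (e : Dec (∃ P)) → ∃ P → P (witnessOr d e)
witnessOr-spec _ (yes (_ , Px)) _  = Px
witnessOr-spec _ (no ¬∃P)       ∃P = contradiction ∃P ¬∃P

module Classical (em : ExcludedMiddle 0ℓ) where

  dne : {P : Set} → ¬ ¬ P → P
  dne = em⇒dne em

  ¬∀⇒∃¬ : {A : Set} {P : A → Set} → ¬ (∀ x → P x) → ∃[ x ] ¬ P x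
  ¬∀⇒∃¬ ¬∀P = dne (λ ¬∃¬P → ¬∀P (λ x → dne (λ ¬Px → ¬∃¬P (x , ¬Px))))

  ¬→⇒×¬ : {P Q : Set} → ¬ (P → Q) → P × ¬ Q
  ¬→⇒×¬ ¬P→Q = dne (λ ¬P → ¬P→Q (λ P → contradiction P ¬P)) , (λ Q → ¬P→Q (λ _ → Q))

  ε : {A : Set} → A → (A → Set) → A
  ε d P = witnessOr d (em {∃ P})

  ε-spec : {A : Set} (d : A) (P : A → Set) → ∃ P → P (ε d P)
  ε-spec d P = witnessOr-spec d em

  least-witness : (P : ℕ → Set) → ∀ {n} → P n → ∃[ m ] P m × (∀ k → k < m → ¬ P k)
  least-witness P {n} = <-rec (λ n → P n → Least) step n
    where
    Least : Set
    Least = ∃[ m ] P m × (∀ k → k < m → ¬ P k)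
    step : ∀ n → (∀ {k} → k < n → P k → Least) → P n → Least
    step n smaller Pn with em {∃[ k ] k < n × P k}
    ... | yes (k , k<n , Pk) = smaller k<n Pk
    ... | no ¬∃k             = n , Pn , λ k k<n Pk → ¬∃k (k , k<n , Pk)

module Space (S : WA2Space) where
  open WA2Space S renaming (≤-refl to ≼-refl; ≤-trans to ≼-trans) public

  Prefix : AR → R → Set
  Prefix c C = ∃[ k ] r C k ≡ c

  lh : AR → ℕ
  lh a = proj₁ (proj₂ (AR-image a))

  lh-spec : ∀ a → IsLh a (lh a)
  lh-spec a = proj₁ (AR-image a) , proj₂ (proj₂ (AR-image a))

  IsLh-unique : ∀ {a m n} → IsLh a m → IsLh a n → m ≡ n
  IsLh-unique (A , rAm≡a) (B , rBn≡a) = proj₁ (A1-3 A B _ _ (trans rAm≡a (sym rBn≡a)))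

  r-agree-below : ∀ A B m → (∀ n → r A (m + n) ≡ r B (m + n)) → ∀ n → r A n ≡ r B n
  r-agree-below A B m agree n = proj₂ (A1-3 A B _ _ (agree (suc n))) n (m≤n+m (suc n) m)

  Restr-weaken : ∀ {A A' b} → Restr A b → A ≼ A' → Restr A' b
  Restr-weaken (n , b≤rAn) A≼A' = let (m , rAn≤rA'm) = w2-⇒ _ _ A≼A' n in m , ≤fin-trans b≤rAn rAn≤rA'm

  Box-weaken : ∀ {c C C' D} → Box c C D → C ≼ C' → Box c C' D
  Box-weaken (D≼C , p) C≼C' = ≼-trans D≼C C≼C' , p

  Box-trans : ∀ {c C D E} → Box c C D → Box c D E → Box c C E
  Box-trans (D≼C , _) (E≼D , p) = ≼-trans E≼D D≼C , p

  -- Run.IILegal as a relation between the position c, I's move A and II's answer (c', B).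
  LegalReply : AR → R → AR → R → Set
  LegalReply c A c' B = (∃[ m ] IsLh c m × RBox (suc m) c A c') × Box c' A B

  LegalReply-weaken : ∀ {c A A' c' B} → LegalReply c A c' B → A ≼ A' → LegalReply c A' c' B
  LegalReply-weaken ((m , lh-c , c'∈A , c⊑c' , lh-c') , B∈A) A≼A' =
    (m , lh-c , Restr-weaken c'∈A A≼A' , c⊑c' , lh-c') , Box-weaken B∈A A≼A'

  LegalReply-shrink : ∀ {c A c' B B'} → LegalReply c A c' B → Box c' B B' → LegalReply c A c' B'
  LegalReply-shrink (step , B∈A) B'∈B = step , Box-trans B∈A B'∈B

  extend-legal : ∀ {c A k} → r A k ≡ c → LegalReply c A (r A (suc k)) A
  extend-legal {A = A} {k} rAk≡c =
    (k , (A , rAk≡c) , (suc k , ≤fin-refl _) , (A , k , suc k , n≤1+n k , rAk≡c , refl) , (A , refl))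
    , ≼-refl A , suc k , refl

  copyMove : AR × R → R → AR × R
  copyMove state A = r A (suc (lh (proj₁ state))) , A

  copyStrategy : AR → IIStrategy
  copyStrategy c = foldl copyMove (c , R-nonempty)

  copyStrategy-follows : ∀ c C As as Bs → FollowsII (copyStrategy c) As as Bs → ∀ n →
    (as n , Bs n) ≡ (r (As n) (suc (lh (Run.cur c C As as Bs n))) , As n)
  copyStrategy-follows c C As as Bs follows n = begin
    (as n , Bs n)                                       ≡⟨ follows n ⟩
    foldl copyMove start (applyUpTo As (suc n))         ≡⟨ cong (foldl copyMove start) (sym (applyUpTo-∷ʳ As n)) ⟩
    foldl copyMove start (applyUpTo As n ∷ʳ As n)       ≡⟨ foldl-∷ʳ copyMove start (As n) (applyUpTo As n) ⟩
    copyMove (copyStrategy c (applyUpTo As n)) (As n)   ≡⟨ cong (λ c' → r (As n) (suc (lh c')) , As n) (position n) ⟩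
    (r (As n) (suc (lh (cur n))) , As n)                ∎
    where
    open Run c C As as Bs
    open ≡-Reasoning
    start : AR × R
    start = c , R-nonempty
    position : ∀ n → proj₁ (copyStrategy c (applyUpTo As n)) ≡ cur n
    position zero    = refl
    position (suc m) = sym (cong proj₁ (follows m))

  copyStrategy-legal : ∀ c C → IILegalStrategy c C (copyStrategy c)
  copyStrategy-legal c C As as Bs follows n I-legal _ with I-legal n ≤-refl
  ... | _ , k , rAk≡cur
    rewrite cong proj₁ (copyStrategy-follows c C As as Bs follows n)
          | cong proj₂ (copyStrategy-follows c C As as Bs follows n)
          | IsLh-unique (lh-spec (Run.cur c C As as Bs n)) (As n , rAk≡cur) = extend-legal rAk≡cur

  module Tail (c : AR) (C : R) (As : ℕ → R) (as : ℕ → AR) (Bs : ℕ → R) where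
    open Run c C As as Bs
    module T = Run (as 0) (Bs 0) (As ∘ suc) (as ∘ suc) (Bs ∘ suc)

    cur-tail : ∀ k → T.cur k ≡ cur (suc k)
    cur-tail zero    = refl
    cur-tail (suc k) = refl

    prev-tail : ∀ k → T.prev k ≡ prev (suc k)
    prev-tail zero    = refl
    prev-tail (suc k) = refl

    ILegal-tail : ∀ k → T.ILegal k ≡ ILegal (suc k)
    ILegal-tail k = cong₂ (λ c' C' → Box c' C' (As (suc k))) (cur-tail k) (prev-tail k)

    IILegal-tail : ∀ k → T.IILegal k ≡ IILegal (suc k)
    IILegal-tail k = cong (λ c' → LegalReply c' (As (suc k)) (as (suc k)) (Bs (suc k))) (cur-tail k)

module Games (em : ExcludedMiddle 0ℓ) (S : WA2Space) where
  open Classical em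
  open Space S

  r-injective : ∀ {A B} → (∀ n → r A n ≡ r B n) → A ≡ B
  r-injective {A} {B} agree = dne λ A≢B → let (n , differ) = A1-2 A B A≢B in differ (agree n)

  Box-inhabited : ∀ {A a} → Restr A a → ∃[ B ] Box a A B
  Box-inhabited {A} {a} (_ , a≤rAn) =
    let (d , a≤rAd , shallower) = least-witness (λ k → a ≤fin r A k) a≤rAn
    in A3-1 A a d (a≤rAd , shallower) A (≼-refl A , d , refl)

  module _ (X : ℕ → R → Set) where

    IIAlternativeFrom : ℕ → AR → R → Set
    IIAlternativeFrom n c C = IIAlternative c C (λ k → X (n + k))

    ¬IReaches-cong : ∀ {c c' C C' m m'} → c ≡ c' → C ≡ C' → m ≡ m' →
                     ¬ IReaches c C (X m) → ¬ IReaches c' C' (X m')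
    ¬IReaches-cong refl refl refl = id

    ¬IReaches⇒IIAlternativeFrom : ∀ {n c C} → ¬ IReaches c C (X n) → IIAlternativeFrom n c C
    ¬IReaches⇒IIAlternativeFrom {n} {c} {C} ¬reach =
      copyStrategy c , copyStrategy-legal c C ,
      λ _ _ _ _ _ → 0 , ¬IReaches-cong refl refl (sym (+-identityʳ n)) ¬reach

    Good : ℕ → AR → R → Set
    Good n c C = ∀ C' → Box c C C' → ¬ IIAlternativeFrom n c C'

    Good⇒IReaches : ∀ {n c C C'} → Good n c C → Box c C C' → IReaches c C' (X n)
    Good⇒IReaches good C'∈C = dne λ ¬reach → good _ C'∈C (¬IReaches⇒IIAlternativeFrom ¬reach)

    record Escape (n : ℕ) (c : AR) (A : R) : Set where
      field
        c'          : AR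
        C'          : R
        reply       : LegalReply c A c' C'
        alternative : IIAlternativeFrom (suc n) c' C'

    module Amalgamation {n c C} (escape : ∀ A → Box c C A → Escape n c A) where

      respond : (A : R) → Dec (Box c C A) → List R → AR × R
      respond A (yes A∈C) []       = Escape.c' (escape A A∈C) , Escape.C' (escape A A∈C)
      respond A (yes A∈C) (A' ∷ l) = proj₁ (Escape.alternative (escape A A∈C)) (A' ∷ l)
      respond A (no _)    _        = c , C

      strategy : IIStrategy
      strategy []      = c , C
      strategy (A ∷ l) = respond A em l

      module _ (As : ℕ → R) (as : ℕ → AR) (Bs : ℕ → R) where
        open Run c C As as Bs
        open Tail c C As as Bs

        IIWinsPlay : Set
        IIWinsPlay = (∀ m → (∀ k → k ≤ m → ILegal k) → (∀ k → k < m → IILegal k) → IILegal m)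
                   × (Complete → ∃[ k ] ¬ IReaches (cur k) (prev k) (X (n + k)))

        continue : LegalReply c (As 0) (as 0) (Bs 0) → (alt : IIAlternativeFrom (suc n) (as 0) (Bs 0)) →
                   FollowsII (proj₁ alt) (As ∘ suc) (as ∘ suc) (Bs ∘ suc) → IIWinsPlay
        continue reply (τ , τ-legal , τ-wins) tail-follows = legal , wins
          where
          legal : ∀ m → (∀ k → k ≤ m → ILegal k) → (∀ k → k < m → IILegal k) → IILegal m
          legal zero    _       _        = reply
          legal (suc m) I-legal II-legal = subst id (IILegal-tail m)
            (τ-legal (As ∘ suc) (as ∘ suc) (Bs ∘ suc) tail-follows m
              (λ k k≤m → subst id (sym (ILegal-tail k)) (I-legal (suc k) (s≤s k≤m)))
              (λ k k<m → subst id (sym (IILegal-tail k)) (II-legal (suc k) (s≤s k<m))))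
          wins : Complete → ∃[ k ] ¬ IReaches (cur k) (prev k) (X (n + k))
          wins complete =
            let (k , ¬reach) = τ-wins (As ∘ suc) (as ∘ suc) (Bs ∘ suc) tail-follows λ k →
                  subst id (sym (ILegal-tail k)) (proj₁ (complete (suc k))) ,
                  subst id (sym (IILegal-tail k)) (proj₂ (complete (suc k)))
            in suc k , ¬IReaches-cong (cur-tail k) (prev-tail k) (sym (+-suc n k)) ¬reach

        fromEscape : (e : Escape n c (As 0)) → (as 0 , Bs 0) ≡ (Escape.c' e , Escape.C' e) →
                     FollowsII (proj₁ (Escape.alternative e)) (As ∘ suc) (as ∘ suc) (Bs ∘ suc) → IIWinsPlay
        fromEscape record { reply = reply ; alternative = alt } refl = continue reply alt

        respond-wins : (d : Dec (Box c C (As 0))) →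
                       (∀ m → (as m , Bs m) ≡ respond (As 0) d (applyUpTo (As ∘ suc) m)) → IIWinsPlay
        respond-wins (yes A∈C) follows = fromEscape (escape (As 0) A∈C) (follows 0) (follows ∘ suc)
        respond-wins (no A∉C)  _       = (λ _ I-legal _ → contradiction (I-legal 0 z≤n) A∉C)
                                       , (λ complete → contradiction (proj₁ (complete 0)) A∉C)

      IIAlternativeFrom-amalgamate : IIAlternativeFrom n c C
      IIAlternativeFrom-amalgamate =
        strategy ,
        (λ As as Bs follows → proj₁ (respond-wins As as Bs em follows)) ,
        (λ As as Bs follows → proj₂ (respond-wins As as Bs em follows))

    open Amalgamation using (IIAlternativeFrom-amalgamate)

    GoodMove : ℕ → AR → R → R → Set
    GoodMove n c C A = Box c C A × (∀ c' B → LegalReply c A c' B → Good (suc n) c' B)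

    -- Were there no good move, every move of I would have an escaping reply, and amalgamating
    -- these replies would refute Good n c C at C itself.
    Good⇒∃GoodMove : ∀ {n c C} → Good n c C → Prefix c C → ∃ (GoodMove n c C)
    Good⇒∃GoodMove {n} {c} {C} good c≺C =
      dne λ ¬∃ → good C (≼-refl C , c≺C) (IIAlternativeFrom-amalgamate (escape ¬∃))
      where
      escape : ¬ ∃ (GoodMove n c C) → ∀ A → Box c C A → Escape n c A
      escape ¬∃ A A∈C =
        let (c' , ¬∀B)             = ¬∀⇒∃¬ λ allGood → ¬∃ (A , A∈C , allGood)
            (B , ¬reply⇒good)      = ¬∀⇒∃¬ ¬∀B
            (reply , ¬good)        = ¬→⇒×¬ ¬reply⇒good
            (C' , ¬C'∈B⇒¬alt)      = ¬∀⇒∃¬ ¬good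
            (C'∈B , ¬¬alt)         = ¬→⇒×¬ ¬C'∈B⇒¬alt
        in record { c' = c' ; C' = C' ; reply = LegalReply-shrink reply C'∈B ; alternative = dne ¬¬alt }

    goodMove : ℕ → AR → R → R
    goodMove n c C = ε C (GoodMove n c C)

    goodMove-spec : ∀ {n c C} → Good n c C → Prefix c C → GoodMove n c C (goodMove n c C)
    goodMove-spec {n} {c} {C} good c≺C = ε-spec C (GoodMove n c C) (Good⇒∃GoodMove good c≺C)

    reachingStrategy : ℕ → AR → R → IStrategy
    reachingStrategy j c C = ε (λ _ → C) (IReachesWith c C (X j))

    reachingStrategy-spec : ∀ {j c C} → IReaches c C (X j) → IReachesWith c C (X j) (reachingStrategy j c C)
    reachingStrategy-spec {j} {c} {C} = ε-spec (λ _ → C) (IReachesWith c C (X j))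

    module Diagonal (a : AR) (B : R) where

      -- layer (j + 1) t is I's move at round t of sub-game j, which starts at round j from
      -- (pos j, layer j j), is played by reachingStrategy for X j and takes layer j (t + 1) as II's
      -- answer. layer 0 t is a good move, each layer shrinks the previous one, and I actually plays
      -- the innermost layer (t + 1) t.
      module Chain (h : ℕ → AR × R) where
        pos : ℕ → AR
        pos zero    = a
        pos (suc t) = proj₁ (h t)

        last : ℕ → R
        last zero    = B
        last (suc t) = proj₂ (h t)

        layer : ℕ → ℕ → R
        layer zero    t = goodMove t (pos t) (last t)
        layer (suc j) t = reachingStrategy j (pos j) (layer j j)
                            (applyUpTo (λ i → proj₁ (h (j + i)) , layer j (suc (j + i))) (t ∸ j))

      module _ {h h' : ℕ → AR × R} (T : ℕ) (h≗h' : ∀ i → i < T → h i ≡ h' i) where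
        private
          module C  = Chain h
          module C' = Chain h'

        pos-local : ∀ t → t ≤ T → C.pos t ≡ C'.pos t
        pos-local zero    _   = refl
        pos-local (suc t) t<T = cong proj₁ (h≗h' t t<T)

        last-local : ∀ t → t ≤ T → C.last t ≡ C'.last t
        last-local zero    _   = refl
        last-local (suc t) t<T = cong proj₂ (h≗h' t t<T)

        layer-local : ∀ j t → j ≤ suc t → t ≤ T → C.layer j t ≡ C'.layer j t
        layer-local zero    t _         t≤T = cong₂ (goodMove t) (pos-local t t≤T) (last-local t t≤T)
        layer-local (suc j) t (s≤s j≤t) t≤T =
          cong₂ _$_ (cong₂ (reachingStrategy j) (pos-local j j≤T) (layer-local j j (n≤1+n j) j≤T))
                    (applyUpTo-cong (t ∸ j) λ i i<t∸j →
                      let j+i<T = <-≤-trans (m≤n⇒o<n∸m⇒m+o<n j≤t i<t∸j) t≤T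
                      in cong₂ _,_ (cong proj₁ (h≗h' (j + i) j+i<T))
                                   (layer-local j (suc (j + i)) (m≤2+[m+n] j i) j+i<T))
          where
          j≤T : j ≤ T
          j≤T = ≤-trans j≤t t≤T

      strategy : IStrategy
      strategy l = Chain.layer (lookupOr (a , B) l) (suc (length l)) (length l)

      strategy-applyUpTo : ∀ h t → strategy (applyUpTo h t) ≡ Chain.layer h (suc t) t
      strategy-applyUpTo h t rewrite length-applyUpTo h t =
        layer-local t (lookupOr-applyUpTo (a , B) h t) (suc t) t ≤-refl ≤-refl

      module Play (good₀ : Good 0 a B) (a≺B : Prefix a B) (As : ℕ → R) (as : ℕ → AR) (Bs : ℕ → R)
                  (follows : ∀ t → As t ≡ Chain.layer (λ k → as k , Bs k) (suc t) t) where
        open Chain (λ k → as k , Bs k)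
        open Run a B As as Bs

        ILegal≡ : ∀ t → ILegal t ≡ Box (pos t) (last t) (As t)
        ILegal≡ zero    = refl
        ILegal≡ (suc t) = refl

        IILegal≡ : ∀ t → IILegal t ≡ LegalReply (pos t) (As t) (as t) (Bs t)
        IILegal≡ zero    = refl
        IILegal≡ (suc t) = refl

        Legal : ℕ → Set
        Legal t = Box (pos t) (last t) (As t) × LegalReply (pos t) (As t) (as t) (Bs t)

        Shrinks : ℕ → ℕ → Set
        Shrinks t j = Box (pos t) (layer j t) (layer (suc j) t)

        Below : ℕ → ℕ → Set
        Below t j = Box (pos t) (last t) (layer j t)

        record Invariant (t : ℕ) : Set where
          field
            good    : Good t (pos t) (last t)
            prefix  : Prefix (pos t) (last t)
            shrinks : ∀ j → j ≤ t → Shrinks t j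
            below   : ∀ j → j ≤ suc t → Below t j

          layer-antitone : ∀ {i j} → i ≤ j → j ≤ suc t → layer j t ≼ layer i t
          layer-antitone {j = zero}  z≤n _ = ≼-refl _
          layer-antitone {i} {suc j} i≤1+j (s≤s j≤t) with m≤n⇒m<n∨m≡n i≤1+j
          ... | inj₁ (s≤s i≤j) = ≼-trans (proj₁ (shrinks j j≤t)) (layer-antitone i≤j (m≤n⇒m≤1+n j≤t))
          ... | inj₂ refl      = ≼-refl _

          As≼layer : ∀ j → j ≤ suc t → As t ≼ layer j t
          As≼layer j j≤1+t = subst (_≼ layer j t) (sym (follows t)) (layer-antitone j≤1+t ≤-refl)

        module SubGame (j : ℕ) where
          As' : ℕ → R
          As' k = layer (suc j) (j + k)

          as' : ℕ → AR
          as' k = as (j + k)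

          Bs' : ℕ → R
          Bs' k = layer j (suc (j + k))

          module G = Run (pos j) (layer j j) As' as' Bs'

          cur≡ : ∀ k → G.cur k ≡ pos (j + k)
          cur≡ zero    = cong pos (sym (+-identityʳ j))
          cur≡ (suc k) = cong pos (sym (+-suc j k))

          prev≡ : ∀ k → G.prev k ≡ layer j (j + k)
          prev≡ zero    = cong (layer j) (sym (+-identityʳ j))
          prev≡ (suc k) = cong (layer j) (sym (+-suc j k))

          ILegal≡Shrinks : ∀ k → G.ILegal k ≡ Shrinks (j + k) j
          ILegal≡Shrinks k = cong₂ (λ c C → Box c C (As' k)) (cur≡ k) (prev≡ k)

          follows' : FollowsI (reachingStrategy j (pos j) (layer j j)) As' as' Bs'
          follows' k = cong (λ m → reachingStrategy j (pos j) (layer j j)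
                                     (applyUpTo (λ i → as (j + i) , layer j (suc (j + i))) m))
                            (m+n∸m≡n j k)

          sub-legal : ∀ k → Invariant (j + k) → Legal (j + k) → Below (suc (j + k)) j →
                      G.ILegal k × G.IILegal k
          sub-legal k inv (_ , reply) below =
            subst id (sym (ILegal≡Shrinks k)) (Invariant.shrinks inv j (m≤m+n j k)) ,
            subst (λ c → LegalReply c (As' k) (as' k) (Bs' k)) (sym (cur≡ k))
              (LegalReply-shrink (LegalReply-weaken reply As≼layer) below)
            where
            As≼layer : As (j + k) ≼ layer (suc j) (j + k)
            As≼layer = Invariant.As≼layer inv (suc j) (s≤s (m≤m+n j k))

        module Round (t : ℕ) (legal : ∀ k → k < t → Legal k) (earlier : ∀ {s} → s < t → Invariant s)
                     (good : Good t (pos t) (last t)) (prefix : Prefix (pos t) (last t)) where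

          goodAt : ∀ {s} → s ≤ t → Good s (pos s) (last s)
          goodAt s≤t = ≤-elim (λ s → Good s (pos s) (last s)) s≤t (Invariant.good ∘ earlier) good

          belowAt : ∀ {s j} → s ≤ t → j ≤ suc s → Below t j → Below s j
          belowAt {j = j} s≤t j≤1+s belowₜ =
            ≤-elim (λ s → Below s j) s≤t (λ s<t → Invariant.below (earlier s<t) j j≤1+s) belowₜ

          -- Shrinks t j is the legality of I's move at round t of sub-game j.
          shrinks : ∀ j → j ≤ t → Below t j → Shrinks t j
          shrinks j j≤t belowₜ =
            subst (λ s → Shrinks s j) (m+[n∸m]≡n j≤t) (subst id (ILegal≡Shrinks (t ∸ j)) I-legal)
            where
            open SubGame j
            reach : IReaches (pos j) (layer j j) (X j)
            reach = Good⇒IReaches (goodAt j≤t) (belowAt j≤t (n≤1+n j) belowₜ)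
            I-legal : G.ILegal (t ∸ j)
            I-legal = proj₁ (reachingStrategy-spec reach As' as' Bs' follows') (t ∸ j) λ k k<t∸j →
              let j+k<t = m≤n⇒o<n∸m⇒m+o<n j≤t k<t∸j
              in sub-legal k (earlier j+k<t) (legal (j + k) j+k<t)
                             (belowAt j+k<t (m≤2+[m+n] j k) belowₜ)

          below : ∀ j → j ≤ suc t → Below t j
          below zero    _     = proj₁ (goodMove-spec good prefix)
          below (suc j) j<1+t = Box-trans belowʲ (shrinks j (≤-pred j<1+t) belowʲ)
            where
            belowʲ : Below t j
            belowʲ = below j (<⇒≤ j<1+t)

          invariant : Invariant t
          invariant = record
            { good    = good
            ; prefix  = prefix
            ; shrinks = λ j j≤t → shrinks j j≤t (below j (m≤n⇒m≤1+n j≤t))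
            ; below   = below
            }

        invariant : ∀ t → (∀ k → k < t → Legal k) → Invariant t
        invariant = <-rec (λ t → (∀ k → k < t → Legal k) → Invariant t) step
          where
          step : ∀ t → (∀ {s} → s < t → (∀ k → k < s → Legal k) → Invariant s) →
                 (∀ k → k < t → Legal k) → Invariant t
          step zero    _   legal = Round.invariant 0 legal (λ ()) good₀ a≺B
          step (suc s) rec legal = Round.invariant (suc s) legal earlier good prefix
            where
            earlier : ∀ {s'} → s' < suc s → Invariant s'
            earlier s'<t = rec s'<t λ k k<s' → legal k (<-trans k<s' s'<t)
            inv : Invariant s
            inv = earlier (n<1+n s)
            reply : LegalReply (pos s) (As s) (as s) (Bs s)
            reply = proj₂ (legal s (n<1+n s))
            good : Good (suc s) (as s) (Bs s)
            good = proj₂ (goodMove-spec (Invariant.good inv) (Invariant.prefix inv)) (as s) (Bs s)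
                     (LegalReply-weaken reply (Invariant.As≼layer inv 0 z≤n))
            prefix : Prefix (as s) (Bs s)
            prefix = proj₂ (proj₂ reply)

        toLegal : ∀ {k} → ILegal k × IILegal k → Legal k
        toLegal {k} (I-legal , II-legal) = subst id (ILegal≡ k) I-legal , subst id (IILegal≡ k) II-legal

        I-legal : ∀ t → (∀ k → k < t → ILegal k × IILegal k) → ILegal t
        I-legal t legal = subst id (sym (ILegal≡ t)) (subst (Box (pos t) (last t)) (sym (follows t))
          (Invariant.below (invariant t λ k k<t → toLegal (legal k k<t)) (suc t) ≤-refl))

        module Outcome (complete : Complete) where
          legal : ∀ k → Legal k
          legal k = toLegal (complete k)

          inv : ∀ t → Invariant t
          inv t = invariant t (λ k _ → legal k)

          k₀ : ℕ
          k₀ = proj₁ a≺B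

          IsLh-a : IsLh a k₀
          IsLh-a = B , proj₂ a≺B

          IsLh-pos : ∀ j → IsLh (pos j) (k₀ + j)
          IsLh-pos zero    = subst (IsLh a) (sym (+-identityʳ k₀)) IsLh-a
          IsLh-pos (suc j) =
            let ((m , IsLh-m , _ , _ , IsLh-1+m) , _) = proj₂ (legal j)
            in subst (IsLh (as j)) (trans (cong suc (IsLh-unique IsLh-m (IsLh-pos j))) (sym (+-suc k₀ j)))
                     IsLh-1+m

          sub-outcome : ∀ j → ∃[ D ] SubGame.G.IsOutcome j D × X j D
          sub-outcome j = proj₂ (reachingStrategy-spec reach As' as' Bs' follows') λ k →
              sub-legal k (inv (j + k)) (legal (j + k)) (Invariant.below (inv (suc (j + k))) j
                                                          (m≤2+[m+n] j k))
            where
            open SubGame j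
            reach : IReaches (pos j) (layer j j) (X j)
            reach = Good⇒IReaches (Invariant.good (inv j)) (Invariant.below (inv j) j (n≤1+n j))

          D₀ : R
          D₀ = proj₁ (sub-outcome 0)

          -- From round j on, sub-games j and 0 run through the same positions.
          sub-outcome-unique : ∀ j → proj₁ (sub-outcome j) ≡ D₀
          sub-outcome-unique j = r-injective (r-agree-below Dⱼ D₀ (k₀ + j) agree)
            where
            Dⱼ : R
            Dⱼ = proj₁ (sub-outcome j)
            agree : ∀ n → r Dⱼ (k₀ + j + n) ≡ r D₀ (k₀ + j + n)
            agree n = begin
              r Dⱼ (k₀ + j + n)        ≡⟨ proj₁ (proj₂ (sub-outcome j)) (k₀ + j) (IsLh-pos j) n ⟩
              SubGame.G.cur j n        ≡⟨ SubGame.cur≡ j n ⟩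
              pos (j + n)              ≡⟨ SubGame.cur≡ 0 (j + n) ⟨
              SubGame.G.cur 0 (j + n)  ≡⟨ proj₁ (proj₂ (sub-outcome 0)) k₀ IsLh-a (j + n) ⟨
              r D₀ (k₀ + (j + n))      ≡⟨ cong (r D₀) (+-assoc k₀ j n) ⟨
              r D₀ (k₀ + j + n)        ∎
              where open ≡-Reasoning

          pos≡cur : ∀ t → pos t ≡ cur t
          pos≡cur zero    = refl
          pos≡cur (suc t) = refl

          outcome : ∃[ D ] IsOutcome D × (∀ n → X n D)
          outcome = D₀ , (λ m IsLh-m n → trans (proj₁ (proj₂ (sub-outcome 0)) m IsLh-m n)
                                               (trans (SubGame.cur≡ 0 n) (pos≡cur n)))
                       , λ j → subst (X j) (sub-outcome-unique j) (proj₂ (proj₂ (sub-outcome j)))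

      strategy-reaches : Good 0 a B → Prefix a B → IReachesWith a B (λ C → ∀ n → X n C) strategy
      strategy-reaches good₀ a≺B As as Bs followsI = I-legal , Outcome.outcome
        where
        follows : ∀ t → As t ≡ Chain.layer (λ k → as k , Bs k) (suc t) t
        follows t = trans (followsI t) (strategy-applyUpTo (λ k → as k , Bs k) t)
        open Play good₀ a≺B As as Bs follows

lemma3p5 : ExcludedMiddle 0ℓ → (S : WA2Space) →
    let open WA2Space S in
    (𝒳 : ℕ → R → Set) → (A : R) → (a : AR) → Restr A a →
    ∃[ B ] Box a A B ×
    (IReaches a B (λ C → ∀ n → 𝒳 n C) ⊎ IIAlternative a B 𝒳)
lemma3p5 em S 𝒳 A a a∈AR↾A = dichotomy
  where
  open Space S
  open Games em S

  dichotomy : ∃[ B ] Box a A B × (IReaches a B (λ C → ∀ n → 𝒳 n C) ⊎ IIAlternative a B 𝒳)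
  dichotomy with em {∃[ B ] Box a A B × IIAlternative a B 𝒳} | Box-inhabited a∈AR↾A
  ... | yes (B , B∈[a,A] , alternative) | _           = B , B∈[a,A] , inj₂ alternative
  ... | no ¬alternative                 | B , B∈[a,A] =
    B , B∈[a,A] , inj₁ (strategy , strategy-reaches good (proj₂ B∈[a,A]))
    where
    open Diagonal 𝒳 a B using (strategy; strategy-reaches)
    good : Good 𝒳 0 a B
    good C C∈[a,B] alternative = ¬alternative (C , Box-weaken C∈[a,B] (proj₁ B∈[a,A]) , alternative)
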